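{- Let $\pi$ be a permutation of size $n$. There is an algorithm that computes one LRM-Partition of $\pi$ using $O(n)$ data comparisons.
   Context: View $\pi$ as an array $\pi[1..n]$ and set $\pi[0]=-\infty$. For $1\le i\le n$ let $\mathrm{PSV}(i)=\max\{j\in[0..i-1]:\pi[j]<\pi[i]\}$. The LRM-Tree $\mathcal{T}_\pi$ is the ordered tree on vertices $\{0,\dots,n\}$ rooted at $0$ where the parent of $i\ge1$ is $\mathrm{PSV}(i)$, children ordered increasingly. An LRM-Partition of $\pi$ is defined recursively: one part is the set of nodes of a "spinal chord" of $\mathcal{T}_\pi$, i.e. one of the longest root-to-leaf paths (the artificial root $0$ not being an element of $\pi$); removing this path leaves a forest of shallower trees, and the remaining parts are obtained by computing and concatenating LRM-Partitions of those trees (in each, again taking a longest root-to-leaf path, removing it, and recursing). Each part, read in increasing order of positions, is an increasing subsequence of $\pi$. A data comparison is a comparison between two entries of $\pi$. -}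

module Defs where

open import Data.Nat using (ℕ; zero; suc)
open import Data.Fin using (Fin; zero; suc; _<_; _<?_)
open import Data.Fin.Permutation using (Permutation′; _⟨$⟩ʳ_)
open import Data.Bool using (Bool)
open import Data.Empty using (⊥)
open import Data.Unit using (⊤)
open import Data.List using (List; []; _∷_; [_]; _++_; length; map)
open import Data.List.Membership.Propositional using (_∈_; _∉_)
open import Data.List.Relation.Unary.Unique.Propositional using (Unique)
open import Data.Product using (Σ; ∃; ∃-syntax; _×_; _,_; proj₁; proj₂)
open import Relation.Nullary using (¬_; does)
open import Function.Bundles using (_⇔_)

-- Nodes of the LRM-tree of a permutation π of size n are Fin (suc n):
-- zero is the artificial root 0 (π[0] = -∞), and suc i is the position
-- i+1 of π, i.e. the entry π ⟨$⟩ʳ i (positions of π are 0-based Fin n).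

Node : ℕ → Set
Node n = Fin (suc n)

Less : ∀ {n} → Permutation′ n → Node n → Node n → Set
Less π _       zero    = ⊥
Less π zero    (suc j) = ⊤
Less π (suc i) (suc j) = (π ⟨$⟩ʳ i) < (π ⟨$⟩ʳ j)

Parent : ∀ {n} → Permutation′ n → Node n → Node n → Set
Parent π p c = (p < c) × Less π p c × (∀ k → p < k → k < c → ¬ Less π k c)

data RootLeafPath {n} (π : Permutation′ n) : Node n → List (Node n) → Set where
  leaf : ∀ r → (∀ c → ¬ Parent π r c) → RootLeafPath π r [ r ]
  step : ∀ r c xs → Parent π r c → RootLeafPath π c xs → RootLeafPath π r (r ∷ xs)

SpinalChord : ∀ {n} → Permutation′ n → Node n → List (Node n) → Set
SpinalChord π r xs =
  RootLeafPath π r xs × (∀ ys → RootLeafPath π r ys → length ys Data.Nat.≤ length xs)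

-- hs lists (without repetition) exactly the roots of the forest obtained by
-- removing the path xs from the subtree containing it: the children of
-- nodes of xs that are not themselves on xs.
HangingRoots : ∀ {n} → Permutation′ n → List (Node n) → List (Node n) → Set
HangingRoots π xs hs =
  Unique hs × (∀ c → (c ∈ hs) ⇔ ((∃[ p ] (p ∈ xs × Parent π p c)) × c ∉ xs))

-- LRM-Partition of the subtree rooted at a node, and of a forest
-- (list of roots); the trees of a forest may be taken in any order.
data LRMTree {n} (π : Permutation′ n) : Node n → List (List (Node n)) → Set
data LRMForest {n} (π : Permutation′ n) : List (Node n) → List (List (Node n)) → Set

data LRMTree π where
  chord : ∀ r xs hs P → SpinalChord π r xs → HangingRoots π xs hs →
          LRMForest π hs P → LRMTree π r (xs ∷ P)

data LRMForest π where
  none : LRMForest π [] []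
  more : ∀ h hs P Q → LRMTree π h P → LRMForest π hs Q → LRMForest π (h ∷ hs) (P ++ Q)

-- An LRM-Partition of π, with parts given as lists of 0-based positions
-- (in increasing order): the first part is the spinal chord of the whole
-- tree with the artificial root 0 removed.
IsLRMPartition : ∀ {n} → Permutation′ n → List (List (Fin n)) → Set
IsLRMPartition π []       = ⊥
IsLRMPartition π (p ∷ ps) = LRMTree π zero ((zero ∷ map suc p) ∷ map (map suc) ps)

-- Comparison model: an algorithm on inputs of size n is a decision tree
-- whose only access to the data is querying "π[i] < π[j] ?".

data Alg (n : ℕ) (A : Set) : Set where
  ret : A → Alg n A
  cmp : Fin n → Fin n → (Bool → Alg n A) → Alg n A

run : ∀ {n} {A : Set} → Permutation′ n → Alg n A → A × ℕ
run π (ret a)     = a , zero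
run π (cmp i j k) with run π (k (does ((π ⟨$⟩ʳ i) <? (π ⟨$⟩ʳ j))))
... | a , m = a , suc m

-- The parent of position i in the LRM-tree is its previous smaller value.
-- Scanning π from left to right, a stack holds the rightmost path of the
-- tree built so far; position i pops every entry with a larger value, and
-- its parent is then the top of the stack.  Each comparison either pops an
-- entry or ends the popping for i, so there are at most 2n comparisons.
-- The parent array determines the tree, and an LRM-Partition is then built
-- bottom-up without looking at the data again: each node extends the
-- longest spinal chord among its children, and the subtrees of its other
-- children join the forest of hanging trees.

module Submission where

open import Defs
open import Data.Nat using (ℕ; _≤_; _*_)
open import Data.Fin using (Fin)
open import Data.Fin.Permutation using (Permutation′)
open import Data.List using (List)
open import Data.Product using (Σ; ∃-syntax; _×_; proj₁; proj₂)

import Data.Nat as ℕ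
open import Data.Nat.Properties
  using ( ≤-refl; ≤-reflexive; <-≤-trans; ≤-trans; +-suc; +-identityʳ; +-monoʳ-≤; +-monoˡ-≤; m≤n+m
        ; ≤∧≢⇒<; ≮⇒≥; <⇒≱; <⇒≤; ≰⇒>; module ≤-Reasoning)
  renaming (_≤?_ to _≤ℕ?_)
open import Data.Nat.Tactic.RingSolver using (solve-∀)
open import Data.Fin using (zero; suc; toℕ; fromℕ<; _<_; _<?_; _≟_)
open import Data.Fin.Properties using (<-cmp; <-trans; <-irrefl; toℕ-fromℕ<; toℕ-injective; toℕ<n; suc-injective)
open import Data.Fin.Permutation using (_⟨$⟩ʳ_)
open import Data.Vec.Functional using (updateAt)
open import Data.Vec.Functional.Properties using (updateAt-updates; updateAt-minimal)
open import Data.Bool using (Bool; true; false)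
open import Data.Empty using (⊥; ⊥-elim)
open import Data.Unit using (⊤; tt)
open import Data.List using ([]; _∷_; [_]; _++_; length; map; filter; allFin; concatMap)
open import Data.List.Properties using (++-assoc; map-∘; map-id)
open import Data.List.Relation.Unary.Any using (here; there)
open import Data.List.Relation.Unary.All as All using (All; []; _∷_)
import Data.List.Relation.Unary.All.Properties as All
open import Data.List.Membership.Propositional using (_∈_; _∉_)
open import Data.List.Membership.Propositional.Properties
  using (∈-map⁺; ∈-map⁻; ∈-++⁻; ∈-++⁺ˡ; ∈-++⁺ʳ; ∈-filter⁺; ∈-filter⁻; ∈-allFin)
open import Data.List.Relation.Unary.Unique.Propositional using (Unique; []; _∷_)
import Data.List.Relation.Unary.Unique.Propositional.Properties as Unique
open import Data.List.Relation.Binary.Permutation.Propositional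
  using (_↭_; ↭-refl; ↭-sym; ↭-trans; prep; swap; ↭⇒↭ₛ)
open import Data.List.Relation.Binary.Permutation.Propositional.Properties using (All-resp-↭; ∈-resp-↭)
  renaming (map⁺ to ↭-map⁺)
open import Data.List.Relation.Binary.Permutation.Setoid.Properties using (Unique-resp-↭)
open import Data.Product using (_,_; map₂; uncurry)
open import Data.Sum using (_⊎_; inj₁; inj₂)
open import Function using (_∘_; const)
open import Function.Bundles using (_⇔_; mk⇔; module Equivalence)
open import Relation.Binary using (tri<; tri≈; tri>)
open import Relation.Binary.PropositionalEquality
  using (_≡_; _≢_; refl; sym; trans; cong; cong₂; subst; setoid)
open import Relation.Nullary using (¬_; Dec; yes; no)
open import Relation.Nullary.Decidable using (dec-true; dec-false)

open Equivalence using (to; from)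

_>>=_ : ∀ {n} {A B : Set} → Alg n A → (A → Alg n B) → Alg n B
ret a     >>= f = f a
cmp i j k >>= f = cmp i j (λ b → k b >>= f)

module _ {n} (π : Permutation′ n) where

  run->>= : ∀ {A B : Set} (m : Alg n A) (f : A → Alg n B) →
            run π (m >>= f) ≡ map₂ (proj₂ (run π m) ℕ.+_) (run π (f (proj₁ (run π m))))
  run->>= (ret a)     f = refl
  run->>= (cmp i j k) f = cong (map₂ ℕ.suc) (run->>= (k _) f)

  run-cmp-< : ∀ {A : Set} {i j} (k : Bool → Alg n A) → π ⟨$⟩ʳ i < π ⟨$⟩ʳ j →
              run π (cmp i j k) ≡ map₂ ℕ.suc (run π (k true))
  run-cmp-< k πi<πj = cong (map₂ ℕ.suc ∘ run π ∘ k) (dec-true (_ <? _) πi<πj)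

  run-cmp-≮ : ∀ {A : Set} {i j} (k : Bool → Alg n A) → ¬ (π ⟨$⟩ʳ i < π ⟨$⟩ʳ j) →
              run π (cmp i j k) ≡ map₂ ℕ.suc (run π (k false))
  run-cmp-≮ k πi≮πj = cong (map₂ ℕ.suc ∘ run π ∘ k) (dec-false (_ <? _) πi≮πj)

module _ {n} (π : Permutation′ n) where

  ≮-trans : ∀ {a b c} → ¬ Less π a b → ¬ Less π b c → ¬ Less π a c
  ≮-trans {c = zero}                    _   _   ()
  ≮-trans {zero}  {zero}  {suc _}       _   b≮c _   = b≮c tt
  ≮-trans {zero}  {suc _} {suc _}       a≮b _   _   = a≮b tt
  ≮-trans {suc _} {zero}  {suc _}       _   b≮c _   = b≮c tt
  ≮-trans {suc _} {suc _} {suc _}       a≮b b≮c a<c = <⇒≱ a<c (≤-trans (≮⇒≥ b≮c) (≮⇒≥ a≮b))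

  parent-unique : ∀ {a b c} → Parent π a c → Parent π b c → a ≡ b
  parent-unique {a} {b} (a<c , a≺c , between-a) (b<c , b≺c , between-b) with <-cmp a b
  ... | tri< a<b _ _ = ⊥-elim (between-a b a<b b<c b≺c)
  ... | tri≈ _ a≡b _ = a≡b
  ... | tri> _ _ b<a = ⊥-elim (between-b a b<a a<c a≺c)

  parent⇒≢zero : ∀ {p c} → Parent π p c → c ≢ zero
  parent⇒≢zero (_ , () , _) refl

  path-root∈ : ∀ {r xs} → RootLeafPath π r xs → r ∈ xs
  path-root∈ (leaf _ _)       = here refl
  path-root∈ (step _ _ _ _ _) = here refl

  path-≥root : ∀ {r xs x} → RootLeafPath π r xs → x ∈ xs → toℕ r ℕ.≤ toℕ x
  path-≥root (leaf _ _)           (here refl) = ≤-refl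
  path-≥root (step _ _ _ _ _)     (here refl) = ≤-refl
  path-≥root (step _ _ _ P p)     (there x∈)  = ≤-trans (<⇒≤ (proj₁ P)) (path-≥root p x∈)

  path-parent : ∀ {r xs x} → RootLeafPath π r xs → x ∈ xs → x ≡ r ⊎ ∃[ p ] (p ∈ xs × Parent π p x)
  path-parent (leaf _ _)         (here refl) = inj₁ refl
  path-parent (step _ _ _ _ _)   (here refl) = inj₁ refl
  path-parent (step r _ _ P p)   (there x∈) with path-parent p x∈
  ... | inj₁ refl           = inj₂ (r , here refl , P)
  ... | inj₂ (q , q∈ , Q)   = inj₂ (q , there q∈ , Q)

  path≢zero : ∀ {r xs} → r ≢ zero → RootLeafPath π r xs → All (_≢ zero) xs
  path≢zero r≢0 (leaf _ _)       = r≢0 ∷ []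
  path≢zero r≢0 (step _ _ _ P p) = r≢0 ∷ path≢zero (parent⇒≢zero P) p

  hangingRoots≢zero : ∀ {xs hs} → HangingRoots π xs hs → All (_≢ zero) hs
  hangingRoots≢zero (_ , roots) =
    All.tabulate λ {c} c∈ → parent⇒≢zero (proj₂ (proj₂ (proj₁ (to (roots c) c∈))))

  lrmTree≢zero : ∀ {h P} → h ≢ zero → LRMTree π h P → All (All (_≢ zero)) P
  lrmForest≢zero : ∀ {hs P} → All (_≢ zero) hs → LRMForest π hs P → All (All (_≢ zero)) P
  lrmTree≢zero h≢0 (chord _ _ _ _ (path , _) hang forest) =
    path≢zero h≢0 path ∷ lrmForest≢zero (hangingRoots≢zero hang) forest
  lrmForest≢zero _              none                = []
  lrmForest≢zero (h≢0 ∷ hs≢0)   (more _ _ _ _ t f)  = All.++⁺ (lrmTree≢zero h≢0 t) (lrmForest≢zero hs≢0 f)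

  lrmForest-++ : ∀ {hs hs′ P Q} → LRMForest π hs P → LRMForest π hs′ Q → LRMForest π (hs ++ hs′) (P ++ Q)
  lrmForest-++                none                 f′ = f′
  lrmForest-++ {hs′ = hs′} {Q = Q′} (more h hs P Q t f) f′ =
    subst (LRMForest π (h ∷ hs ++ hs′)) (sym (++-assoc P Q Q′))
      (more h (hs ++ hs′) P (Q ++ Q′) t (lrmForest-++ f f′))

-- Computing all previous smaller values with a stack

topNode : ∀ {n} → List (Fin n) → Node n
topNode []      = zero
topNode (j ∷ _) = suc j

popLarger : ∀ {n} → Fin n → List (Fin n) → Alg n (List (Fin n))
popUnless : ∀ {n} → Fin n → Fin n → List (Fin n) → Bool → Alg n (List (Fin n))
popLarger i []       = ret []
popLarger i (j ∷ st) = cmp j i (popUnless i j st)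
popUnless i j st true  = ret (j ∷ st)
popUnless i j st false = popLarger i st

index<n : ∀ {n} k r → ℕ.suc r ℕ.+ k ≡ n → k ℕ.< n
index<n k r eq = subst (ℕ.suc k ℕ.≤_) eq (ℕ.s≤s (m≤n+m k r))

-- Processes the positions k, k + 1, …, k + r - 1; the stack lists the
-- rightmost path of the LRM-tree on the positions below k, deepest first.
psvFrom : ∀ {n} (k r : ℕ) → r ℕ.+ k ≡ n → List (Fin n) → (Fin n → Node n) → Alg n (Fin n → Node n)
psvFrom k ℕ.zero    _  _  psv = ret psv
psvFrom k (ℕ.suc r) eq st psv =
  popLarger i st >>= λ st′ →
  psvFrom (ℕ.suc k) r (trans (+-suc r k) eq) (i ∷ st′) (updateAt psv i (const (topNode st′)))
  where i = fromℕ< (index<n k r eq)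

psvArray : ∀ n → Alg n (Fin n → Node n)
psvArray n = psvFrom 0 n (+-identityʳ n) [] (const zero)

module _ {n} (π : Permutation′ n) where

  PopsPaidBy : ℕ → List (Fin n) × ℕ → Set
  PopsPaidBy s (st′ , pops) = pops ℕ.+ length st′ ≤ ℕ.suc s

  popLarger-cost : ∀ i st → PopsPaidBy (length st) (run π (popLarger i st))
  popLarger-cost i []       = ℕ.z≤n
  popLarger-cost i (j ∷ st) with π ⟨$⟩ʳ j <? π ⟨$⟩ʳ i
  ... | yes πj<πi = subst (PopsPaidBy _) (sym (run-cmp-< π (popUnless i j st) πj<πi)) ≤-refl
  ... | no  πj≮πi = subst (PopsPaidBy _) (sym (run-cmp-≮ π (popUnless i j st) πj≮πi))
                      (ℕ.s≤s (popLarger-cost i st))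

  -- Every position is pushed once and popped at most once.
  psvFrom-cost : ∀ k r eq st psv → proj₂ (run π (psvFrom k r eq st psv)) ≤ 2 * r ℕ.+ length st
  psvFrom-cost k ℕ.zero    eq st psv = ℕ.z≤n
  psvFrom-cost k (ℕ.suc r) eq st psv = begin
        proj₂ (run π (psvFrom k (ℕ.suc r) eq st psv)) ≡⟨ cong proj₂ (run->>= π (popLarger i st) _) ⟩
        pops ℕ.+ rest                            ≤⟨ +-monoʳ-≤ pops (psvFrom-cost (ℕ.suc k) r _ (i ∷ st′) _) ⟩
        pops ℕ.+ (2 * r ℕ.+ ℕ.suc (length st′))  ≡⟨ shuffle pops r (length st′) ⟩
        2 * r ℕ.+ ℕ.suc (pops ℕ.+ length st′)    ≤⟨ +-monoʳ-≤ (2 * r) (ℕ.s≤s (popLarger-cost i st)) ⟩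
        2 * r ℕ.+ ℕ.suc (ℕ.suc (length st))      ≡⟨ regroup r (length st) ⟩
        2 * ℕ.suc r ℕ.+ length st                ∎
    where
    open ≤-Reasoning
    i = fromℕ< (index<n k r eq)
    st′ = proj₁ (run π (popLarger i st))
    pops = proj₂ (run π (popLarger i st))
    rest = proj₂ (run π (psvFrom (ℕ.suc k) r _ (i ∷ st′) (updateAt psv i (const (topNode st′)))))
    shuffle : ∀ a r b → a ℕ.+ (2 * r ℕ.+ ℕ.suc b) ≡ 2 * r ℕ.+ ℕ.suc (a ℕ.+ b)
    shuffle = solve-∀
    regroup : ∀ r b → 2 * r ℕ.+ ℕ.suc (ℕ.suc b) ≡ 2 * ℕ.suc r ℕ.+ b
    regroup = solve-∀

  AllLargerBetween : Node n → Node n → Set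
  AllLargerBetween p c = ∀ m → p < m → m < c → ¬ Less π m c

  ParentChain : List (Fin n) → Set
  ParentChain []       = ⊤
  ParentChain (j ∷ st) = Parent π (topNode st) (suc j) × ParentChain st

  popLarger-correct : ∀ i st → ParentChain st → topNode st < suc i → AllLargerBetween (topNode st) (suc i) →
                      ParentChain (i ∷ proj₁ (run π (popLarger i st)))
  popLarger-correct i []       _     top<i between = (top<i , tt , between) , tt
  popLarger-correct i (j ∷ st) chain top<i between with π ⟨$⟩ʳ j <? π ⟨$⟩ʳ i
  ... | yes πj<πi = subst (ParentChain ∘ (i ∷_) ∘ proj₁) (sym (run-cmp-< π (popUnless i j st) πj<πi))
                      ((top<i , πj<πi , between) , chain)
  ... | no  πj≮πi = subst (ParentChain ∘ (i ∷_) ∘ proj₁) (sym (run-cmp-≮ π (popUnless i j st) πj≮πi))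
                      (popLarger-correct i st (proj₂ chain) (<-trans st<j top<i) between′)
    where
    st<j : topNode st < suc j
    st<j = proj₁ (proj₁ chain)
    between′ : AllLargerBetween (topNode st) (suc i)
    between′ m st<m m<i with <-cmp m (suc j)
    ... | tri< m<j _ _  = ≮-trans π (proj₂ (proj₂ (proj₁ chain)) m st<m m<j) πj≮πi
    ... | tri≈ _ refl _ = πj≮πi
    ... | tri> _ _ j<m  = between m j<m m<i

  ParentsBelow : (Fin n → Node n) → ℕ → Set
  ParentsBelow psv k = ∀ j → toℕ j ℕ.< k → Parent π (psv j) (suc j)

  psvFrom-correct : ∀ k r eq st psv → ParentChain st → toℕ (topNode st) ≡ k → ParentsBelow psv k →
                    ParentsBelow (proj₁ (run π (psvFrom k r eq st psv))) n
  psvFrom-correct k ℕ.zero    refl st psv _     _   parents = parents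
  psvFrom-correct k (ℕ.suc r) eq   st psv chain top parents =
    subst (λ p → ParentsBelow (proj₁ p) n) (sym (run->>= π (popLarger i st) _))
      (psvFrom-correct (ℕ.suc k) r _ (i ∷ st′) _ chain′ (cong ℕ.suc i≡k) parents′)
    where
    i = fromℕ< (index<n k r eq)
    i≡k : toℕ i ≡ k
    i≡k = toℕ-fromℕ< (index<n k r eq)
    st<i : topNode st < suc i
    st<i = ℕ.s≤s (≤-reflexive (trans top (sym i≡k)))
    between : AllLargerBetween (topNode st) (suc i)
    between m st<m m<i = ⊥-elim (<⇒≱ st<m (subst (toℕ m ℕ.≤_) (trans i≡k (sym top)) (ℕ.s≤s⁻¹ m<i)))
    st′ = proj₁ (run π (popLarger i st))
    chain′ : ParentChain (i ∷ st′)
    chain′ = popLarger-correct i st chain st<i between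
    parents′ : ParentsBelow (updateAt psv i (const (topNode st′))) (ℕ.suc k)
    parents′ j j<k with j ≟ i
    ... | yes refl = subst (λ p → Parent π p (suc j)) (sym (updateAt-updates j psv)) (proj₁ chain′)
    ... | no  j≢i  = subst (λ p → Parent π p (suc j)) (sym (updateAt-minimal j i psv j≢i))
                       (parents j (≤∧≢⇒< (ℕ.s≤s⁻¹ j<k) (j≢i ∘ toℕ-injective ∘ (λ e → trans e (sym i≡k)))))

  psvArray-correct : ∀ j → Parent π (proj₁ (run π (psvArray n)) j) (suc j)
  psvArray-correct j = psvFrom-correct 0 n (+-identityʳ n) [] (const zero) tt refl (λ _ ()) j (toℕ<n j)

  psvArray-cost : proj₂ (run π (psvArray n)) ≤ 2 * n
  psvArray-cost = subst (proj₂ (run π (psvArray n)) ≤_) (+-identityʳ (2 * n))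
                    (psvFrom-cost 0 n (+-identityʳ n) [] (const zero))

module _ {A : Set} (weight : A → ℕ) where

  heavierOf : (x b : A) → List A → Dec (weight b ≤ weight x) → A × List A
  heavierOf x b rest (yes _) = x , b ∷ rest
  heavierOf x b rest (no _)  = b , x ∷ rest

  extractMax : A → List A → A × List A
  extractMax x []       = x , []
  extractMax x (y ∷ ys) = uncurry (λ b rest → heavierOf x b rest (weight b ≤ℕ? weight x)) (extractMax y ys)

  heavierOf-↭ : ∀ x b rest d → uncurry _∷_ (heavierOf x b rest d) ↭ x ∷ b ∷ rest
  heavierOf-↭ x b rest (yes _) = ↭-refl
  heavierOf-↭ x b rest (no _)  = swap b x ↭-refl

  extractMax-↭ : ∀ x ys → uncurry _∷_ (extractMax x ys) ↭ x ∷ ys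
  extractMax-↭ x []       = ↭-refl
  extractMax-↭ x (y ∷ ys) = ↭-trans (heavierOf-↭ x _ _ (_ ≤ℕ? weight x)) (prep x (extractMax-↭ y ys))

  Lighter : A × List A → Set
  Lighter (b , rest) = All (λ y → weight y ≤ weight b) rest

  heavierOf-lighter : ∀ x b rest d → Lighter (b , rest) → Lighter (heavierOf x b rest d)
  heavierOf-lighter x b rest (yes b≤x) lighter = b≤x ∷ All.map (λ y≤b → ≤-trans y≤b b≤x) lighter
  heavierOf-lighter x b rest (no b≰x)  lighter = <⇒≤ (≰⇒> b≰x) ∷ lighter

  extractMax-lighter : ∀ x ys → Lighter (extractMax x ys)
  extractMax-lighter x []       = []
  extractMax-lighter x (y ∷ ys) = heavierOf-lighter x _ _ (_ ≤ℕ? weight x) (extractMax-lighter y ys)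

ChildList : ∀ {n} → Permutation′ n → Node n → List (Node n) → Set
ChildList π r cs = Unique cs × (∀ c → c ∈ cs ⇔ Parent π r c)

module _ {n} (π : Permutation′ n) where

  childList-resp-↭ : ∀ {r cs ds} → cs ↭ ds → ChildList π r cs → ChildList π r ds
  childList-resp-↭ cs↭ds (unique , children) =
    Unique-resp-↭ (setoid _) (↭⇒↭ₛ cs↭ds) unique ,
    λ c → mk⇔ (to (children c) ∘ ∈-resp-↭ (↭-sym cs↭ds)) (∈-resp-↭ cs↭ds ∘ from (children c))

  spinalChord-leaf : ∀ {r} → ChildList π r [] → SpinalChord π r [ r ]
  spinalChord-leaf {r} (_ , children) = leaf r (λ c → childless ∘ from (children c)) , longest
    where
    childless : ∀ {c} → ¬ c ∈ []
    childless ()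
    longest : ∀ ys → RootLeafPath π r ys → length ys ≤ 1
    longest _ (leaf _ _)         = ≤-refl
    longest _ (step _ c _ P _)   = ⊥-elim (childless (from (children c) P))

  hangingRoots-leaf : ∀ {r} → ChildList π r [] → HangingRoots π [ r ] []
  hangingRoots-leaf {r} (_ , children) = [] , λ c → mk⇔ (λ ()) λ where
    ((_ , here refl , P) , _) → from (children c) P

  spinalChord-extend : ∀ {r c xs} → Parent π r c → SpinalChord π c xs →
                       (∀ d ys → Parent π r d → RootLeafPath π d ys → length ys ≤ length xs) →
                       SpinalChord π r (r ∷ xs)
  spinalChord-extend {r} {c} {xs} P (path , _) shorter = step r c xs P path , longest
    where
    longest : ∀ ys → RootLeafPath π r ys → length ys ≤ ℕ.suc (length xs)
    longest _ (leaf _ _)          = ℕ.s≤s ℕ.z≤n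
    longest _ (step _ d ys Q p)   = ℕ.s≤s (shorter d ys Q p)

  hangingRoots-extend : ∀ {r c cs xs hs} → ChildList π r (c ∷ cs) → RootLeafPath π c xs →
                        HangingRoots π xs hs → HangingRoots π (r ∷ xs) (cs ++ hs)
  hangingRoots-extend {r} {c} {cs} {xs} {hs} (c∉cs ∷ unique , children) path (uniqueHs , roots) =
    Unique.++⁺ unique uniqueHs (λ (d∈cs , d∈hs) → notBoth d∈cs d∈hs) , λ d → mk⇔ (sound d) (complete d)
    where
    r<c : r < c
    r<c = proj₁ (to (children c) (here refl))
    r<path : ∀ {p} → p ∈ xs → r < p
    r<path p∈ = <-≤-trans r<c (path-≥root π path p∈)
    notSibling : ∀ {p d} → p ∈ xs → Parent π p d → ¬ Parent π r d
    notSibling p∈ Ppd Prd with parent-unique π Ppd Prd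
    ... | refl = <-irrefl refl (r<path p∈)
    notBoth : ∀ {d} → d ∈ cs → d ∈ hs → ⊥
    notBoth d∈cs d∈hs with to (roots _) d∈hs
    ... | (p , p∈ , Ppd) , _ = notSibling p∈ Ppd (to (children _) (there d∈cs))
    sound : ∀ d → d ∈ cs ++ hs → (∃[ p ] (p ∈ r ∷ xs × Parent π p d)) × d ∉ r ∷ xs
    sound d d∈ with ∈-++⁻ cs d∈
    ... | inj₁ d∈cs = (r , here refl , Prd) , λ where
            (here refl)  → <-irrefl refl (proj₁ Prd)
            (there d∈xs) → offPath d∈xs
      where
      Prd = to (children d) (there d∈cs)
      offPath : d ∉ xs
      offPath d∈xs with path-parent π path d∈xs
      ... | inj₁ refl            = All.lookup c∉cs d∈cs refl
      ... | inj₂ (p , p∈ , Ppd)  = notSibling p∈ Ppd Prd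
    ... | inj₂ d∈hs with to (roots d) d∈hs
    ... | (p , p∈ , Ppd) , d∉xs = (p , there p∈ , Ppd) , λ where
            (here refl)  → <-irrefl refl (<-trans (r<path p∈) (proj₁ Ppd))
            (there d∈xs) → d∉xs d∈xs
    complete : ∀ d → (∃[ p ] (p ∈ r ∷ xs × Parent π p d)) × d ∉ r ∷ xs → d ∈ cs ++ hs
    complete d ((_ , here refl , Prd) , d∉) with from (children d) Prd
    ... | here refl = ⊥-elim (d∉ (there (path-root∈ π path)))
    ... | there d∈cs = ∈-++⁺ˡ d∈cs
    complete d ((p , there p∈ , Ppd) , d∉) = ∈-++⁺ʳ cs (from (roots d) ((p , p∈ , Ppd) , d∉ ∘ there))

-- LRM-Partitions from the parent array, without further comparisons

record Decomposition (n : ℕ) : Set where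
  constructor decomposition
  field
    spine   : List (Node n)
    hanging : List (Node n)
    parts   : List (List (Node n))
open Decomposition

Subtree : ℕ → Set
Subtree n = Node n × Decomposition n

spineLength : ∀ {n} → Subtree n → ℕ
spineLength = length ∘ spine ∘ proj₂

forestParts : ∀ {n} → List (Subtree n) → List (List (Node n))
forestParts = concatMap λ (_ , D) → spine D ∷ parts D

attach : ∀ {n} → Node n → Subtree n × List (Subtree n) → Decomposition n
attach r ((_ , D) , others) =
  decomposition (r ∷ spine D) (map proj₁ others ++ hanging D) (forestParts others ++ parts D)

combine : ∀ {n} → Node n → List (Subtree n) → Decomposition n
combine r []       = decomposition [ r ] [] []
combine r (t ∷ ts) = attach r (extractMax spineLength t ts)

children : ∀ {n} → (Fin n → Node n) → Node n → List (Node n)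
children {n} psv r = map suc (filter (λ i → psv i ≟ r) (allFin n))

-- Children have larger indices than their parent, so fuel n + 1 - r suffices at node r.
decompose : ∀ {n} → (Fin n → Node n) → ℕ → Node n → Decomposition n
decompose psv ℕ.zero    r = decomposition [ r ] [] []
decompose psv (ℕ.suc f) r = combine r (map (λ c → c , decompose psv f c) (children psv r))

module _ {n} (π : Permutation′ n) where

  IsDecomposition : Node n → Decomposition n → Set
  IsDecomposition r D =
    SpinalChord π r (spine D) × HangingRoots π (spine D) (hanging D) × LRMForest π (hanging D) (parts D)

  IsSubtree : Subtree n → Set
  IsSubtree = uncurry IsDecomposition

  forestParts-correct : ∀ {ts} → All IsSubtree ts → LRMForest π (map proj₁ ts) (forestParts ts)
  forestParts-correct []                                        = none
  forestParts-correct {(c , D) ∷ _} ((chord′ , hang , forest) ∷ ok) =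
    more c _ (spine D ∷ parts D) _ (chord c _ _ _ chord′ hang forest) (forestParts-correct ok)

  attach-correct : ∀ r b others → All IsSubtree (b ∷ others) → ChildList π r (map proj₁ (b ∷ others)) →
                   Lighter spineLength (b , others) → IsDecomposition r (attach r (b , others))
  attach-correct r (c , D) others ok@((chord′ , hang , forest) ∷ okOthers) childList@(_ , children) lighter =
    spinalChord-extend π (to (children c) (here refl)) chord′ shorter ,
    hangingRoots-extend π childList (proj₁ chord′) hang ,
    lrmForest-++ π (forestParts-correct okOthers) forest
    where
    shorter : ∀ d ys → Parent π r d → RootLeafPath π d ys → length ys ≤ length (spine D)
    shorter d ys Prd path with ∈-map⁻ proj₁ (from (children d) Prd)
    ... | t , t∈ , refl = ≤-trans (proj₂ (proj₁ (All.lookup ok t∈)) ys path) (All.lookup (≤-refl ∷ lighter) t∈)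

  combine-correct : ∀ r ts → All IsSubtree ts → ChildList π r (map proj₁ ts) → IsDecomposition r (combine r ts)
  combine-correct r []       _  childList = spinalChord-leaf π childList , hangingRoots-leaf π childList , none
  combine-correct r (t ∷ ts) ok childList =
    attach-correct r _ _ (All-resp-↭ (↭-sym max↭) ok)
      (childList-resp-↭ π (↭-map⁺ proj₁ (↭-sym max↭)) childList) (extractMax-lighter spineLength t ts)
    where max↭ = extractMax-↭ spineLength t ts

module _ {n} (π : Permutation′ n) {psv : Fin n → Node n} (psv-correct : ∀ i → Parent π (psv i) (suc i)) where

  children-correct : ∀ r → ChildList π r (children psv r)
  children-correct r =
    Unique.map⁺ suc-injective (Unique.filter⁺ (λ i → psv i ≟ r) (Unique.allFin⁺ n)) ,
    λ c → mk⇔ sound (complete c)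
    where
    sound : ∀ {c} → c ∈ children psv r → Parent π r c
    sound c∈ with ∈-map⁻ suc c∈
    ... | i , i∈ , refl =
      subst (λ p → Parent π p (suc i)) (proj₂ (∈-filter⁻ (λ i → psv i ≟ r) {xs = allFin n} i∈)) (psv-correct i)
    complete : ∀ c → Parent π r c → c ∈ children psv r
    complete zero    (_ , () , _)
    complete (suc i) Prc =
      ∈-map⁺ suc (∈-filter⁺ (λ i → psv i ≟ r) (∈-allFin i) (parent-unique π (psv-correct i) Prc))

  decompose-correct : ∀ f r → ℕ.suc n ≤ toℕ r ℕ.+ f → IsDecomposition π r (decompose psv f r)
  decompose-correct ℕ.zero    r enough =
    ⊥-elim (<⇒≱ (toℕ<n r) (subst (ℕ.suc n ≤_) (+-identityʳ _) enough))
  decompose-correct (ℕ.suc f) r enough =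
    combine-correct π r subtrees (All.map⁺ (All.tabulate (λ c∈ → decompose-correct f _ (deeper c∈))))
      (subst (ChildList π r) (sym (map-proj₁ (children psv r))) (children-correct r))
    where
    subtrees = map (λ c → c , decompose psv f c) (children psv r)
    map-proj₁ : ∀ cs → map proj₁ (map (λ c → c , decompose psv f c) cs) ≡ cs
    map-proj₁ cs = trans (sym (map-∘ cs)) (map-id cs)
    deeper : ∀ {c} → c ∈ children psv r → ℕ.suc n ≤ toℕ c ℕ.+ f
    deeper {c} c∈ = ≤-trans enough (≤-trans (≤-reflexive (+-suc (toℕ r) f))
                      (+-monoˡ-≤ f (proj₁ (to (proj₂ (children-correct r) c) c∈))))

strip : ∀ {n} → List (Node n) → List (Fin n)
strip []           = []
strip (zero  ∷ xs) = strip xs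
strip (suc i ∷ xs) = i ∷ strip xs

map-suc-strip : ∀ {n} {xs : List (Node n)} → All (_≢ zero) xs → map suc (strip xs) ≡ xs
map-suc-strip                  []         = refl
map-suc-strip {xs = zero  ∷ _} (0≢0 ∷ _)  = ⊥-elim (0≢0 refl)
map-suc-strip {xs = suc i ∷ _} (_ ∷ ok)   = cong (suc i ∷_) (map-suc-strip ok)

map-map-suc-strip : ∀ {n} {xss : List (List (Node n))} → All (All (_≢ zero)) xss →
                    map (map suc) (map strip xss) ≡ xss
map-map-suc-strip []         = refl
map-map-suc-strip (ok ∷ oks) = cong₂ _∷_ (map-suc-strip ok) (map-map-suc-strip oks)

lrmPartition : ∀ {n} → (Fin n → Node n) → List (List (Fin n))
lrmPartition {n} psv = map strip (spine D ∷ parts D)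
  where D = decompose psv (ℕ.suc n) zero

lrmPartitionAlg : ∀ n → Alg n (List (List (Fin n)))
lrmPartitionAlg n = psvArray n >>= (ret ∘ lrmPartition)

module _ {n} (π : Permutation′ n) where

  spine-from-root : ∀ {xs} → RootLeafPath π zero xs → zero ∷ map suc (strip xs) ≡ xs
  spine-from-root (leaf _ _)         = refl
  spine-from-root (step _ _ _ P path) = cong (zero ∷_) (map-suc-strip (path≢zero π (parent⇒≢zero π P) path))

  lrmPartition-correct : ∀ {psv} → (∀ i → Parent π (psv i) (suc i)) → IsLRMPartition π (lrmPartition psv)
  lrmPartition-correct {psv} psv-correct =
    subst (LRMTree π zero) (cong₂ _∷_ (sym (spine-from-root (proj₁ chord′)))
                                      (sym (map-map-suc-strip (lrmForest≢zero π (hangingRoots≢zero π hang) forest))))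
      (chord zero _ _ _ chord′ hang forest)
    where
    ok = decompose-correct π psv-correct (ℕ.suc n) zero ≤-refl
    chord′ = proj₁ ok
    hang = proj₁ (proj₂ ok)
    forest = proj₂ (proj₂ ok)

  lrmPartitionAlg-correct : IsLRMPartition π (proj₁ (run π (lrmPartitionAlg n)))
  lrmPartitionAlg-correct = subst (IsLRMPartition π ∘ proj₁) (sym (run->>= π (psvArray n) (ret ∘ lrmPartition)))
                              (lrmPartition-correct (psvArray-correct π))

  lrmPartitionAlg-cost : proj₂ (run π (lrmPartitionAlg n)) ≤ 2 * n
  lrmPartitionAlg-cost = subst ((_≤ 2 * n) ∘ proj₂) (sym (run->>= π (psvArray n) (ret ∘ lrmPartition)))
                           (≤-trans (≤-reflexive (+-identityʳ _)) (psvArray-cost π))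

lemma4 : ∃[ c ] ∃[ n₀ ] Σ ((n : ℕ) → Alg n (List (List (Fin n)))) λ alg →
           ∀ n (π : Permutation′ n) →
             IsLRMPartition π (proj₁ (run π (alg n)))
             × (n₀ ≤ n → proj₂ (run π (alg n)) ≤ c * n)
lemma4 = 2 , 0 , lrmPartitionAlg , λ n π → lrmPartitionAlg-correct π , λ _ → lrmPartitionAlg-cost π
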